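{- Let $k$ be a positive integer and let $T$ be a tree of order $2k+3$ and diameter at most four with $p'\geq 2$. Let $H$ be a bipartite graph with parts $X$ and $Y$ such that $|X|\geq e(F_T)$ and $|Y|\geq p'$. If there exist distinct vertices $y_0,y_1,\ldots,y_{p'-1}\in Y$ such that $d_H(y_0)\geq e(F_T)$ and $d_H(y_i)\geq e(F_T)-1$ for all $i\in\{1,\ldots,p'-1\}$, then $H$ contains a copy of $F_T$ in which the centers of all components lie in $Y$.
   Context: A tree of diameter at most four is viewed as rooted at its center; if it has two adjacent centers, the root is the center $v$ for which $T-v$ has the largest number of components. Deleting the root yields a forest each of whose components is a star $K_{1,m}$ ($m\geq 0$, where $K_{1,0}=K_1$ is a trivial star). $F_T$ denotes the star forest consisting of all nontrivial stars (those with $m\geq1$) among the components of $T$ minus its root, $p'$ is the number of components of $F_T$, and $e(F_T)$ is the number of edges of $F_T$. For a component $K_{1,1}$, either endpoint may serve as its center. -}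

module Defs where

open import Data.Nat using (ℕ; zero; suc; _≤_; _<_)
open import Data.Fin using (Fin) renaming (_<_ to _<ᶠ_)
open import Data.Fin.Properties using (_≟_) renaming (_<?_ to _<ᶠ?_)
open import Data.Sum using (_⊎_; inj₁; inj₂)
open import Data.Product using (Σ; ∃; _×_; _,_; proj₁; proj₂)
open import Data.Product.Properties using ()
open import Data.Unit using (⊤)
open import Data.Empty using (⊥)
open import Data.Maybe using (Maybe; just)
open import Data.List using (List; []; _∷_; length; filter; allFin; head; last; cartesianProduct)
open import Data.List.Relation.Unary.All using (All)
open import Data.List.Relation.Unary.Unique.Propositional using (Unique)
open import Relation.Nullary using (¬_; Dec; yes; no)
open import Relation.Nullary.Decidable using (_×-dec_; ¬?)
open import Relation.Binary using (Decidable)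
open import Relation.Binary.PropositionalEquality using (_≡_; _≢_)

record Graph (n : ℕ) : Set₁ where
  field
    _~_    : Fin n → Fin n → Set
    ~-dec  : Decidable _~_
    ~-sym  : ∀ {u v} → u ~ v → v ~ u
    ~-irr  : ∀ {u} → ¬ (u ~ u)

module _ {n : ℕ} (G : Graph n) where
  open Graph G

  deg : Fin n → ℕ
  deg u = length (filter (~-dec u) (allFin n))

  IsWalk : List (Fin n) → Set
  IsWalk []           = ⊤
  IsWalk (x ∷ [])     = ⊤
  IsWalk (x ∷ y ∷ xs) = (x ~ y) × IsWalk (y ∷ xs)

  WalkFromTo : Fin n → Fin n → List (Fin n) → Set
  WalkFromTo u v xs = IsWalk xs × (head xs ≡ just u) × (last xs ≡ just v)

  Connected : Set
  Connected = ∀ u v → ∃ λ xs → WalkFromTo u v xs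

  IsCycle : List (Fin n) → Set
  IsCycle xs = (3 ≤ length xs) × Unique xs × IsWalk xs
             × ∃ λ u → ∃ λ v → (head xs ≡ just u) × (last xs ≡ just v) × (v ~ u)

  Acyclic : Set
  Acyclic = ∀ xs → ¬ IsCycle xs

  IsTree : Set
  IsTree = Connected × Acyclic

  DistLe : Fin n → Fin n → ℕ → Set
  DistLe u v d = ∃ λ xs → WalkFromTo u v xs × (length xs ≤ suc d)

  DiamLe : ℕ → Set
  DiamLe d = ∀ u v → DistLe u v d

  EccLe : Fin n → ℕ → Set
  EccLe v e = ∀ u → DistLe v u e

  IsCenter : Fin n → Set
  IsCenter v = ∀ w e → EccLe w e → EccLe v e

  -- the root: a center r such that T - r has the largest number of
  -- components among centers; in a tree the number of components of
  -- T - v equals deg v.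
  IsRoot : Fin n → Set
  IsRoot r = IsCenter r × (∀ w → IsCenter w → deg w ≤ deg r)

  -- The star forest F_T for a chosen root r: T - r with its trivial
  -- (isolated) components removed.

  InF : Fin n → Fin n → Set
  InF r v = (v ≢ r) × ∃ λ w → (w ≢ r) × (v ~ w)

  SameComp : Fin n → Fin n → Fin n → Set
  SameComp r u v = ∃ λ xs → WalkFromTo u v xs × All (λ x → x ≢ r) xs

  NumComps : Fin n → ℕ → Set
  NumComps r p = Σ (Fin p → Fin n) λ rep →
      (∀ i → InF r (rep i))
    × (∀ i j → SameComp r (rep i) (rep j) → i ≡ j)
    × (∀ v → InF r v → ∃ λ i → SameComp r v (rep i))

  eF : Fin n → ℕ
  eF r = length (filter dec (cartesianProduct (allFin n) (allFin n)))
    where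
      dec : (p : Fin n × Fin n) → Dec (((proj₁ p <ᶠ proj₂ p) × (proj₁ p ~ proj₂ p))
                                       × ((¬ proj₁ p ≡ r) × (¬ proj₂ p ≡ r)))
      dec (u , v) = ((u <ᶠ? v) ×-dec ~-dec u v) ×-dec (¬? (u ≟ r) ×-dec ¬? (v ≟ r))

record BipGraph (a b : ℕ) : Set₁ where
  field
    E     : Fin a → Fin b → Set
    E-dec : Decidable E

module _ {a b : ℕ} (H : BipGraph a b) where
  open BipGraph H

  VH : Set
  VH = Fin a ⊎ Fin b

  AdjH : VH → VH → Set
  AdjH (inj₁ x) (inj₂ y) = E x y
  AdjH (inj₂ y) (inj₁ x) = E x y
  AdjH _        _        = ⊥

  InY : VH → Set
  InY (inj₁ _) = ⊥
  InY (inj₂ _) = ⊤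

  degY : Fin b → ℕ
  degY y = length (filter (λ x → E-dec x y) (allFin a))

  CopyWithCentersInY : ∀ {n} (T : Graph n) → Fin n → Set
  CopyWithCentersInY {n} T r = Σ (Fin n → VH) λ φ →
      (∀ u v → InF T r u → InF T r v → φ u ≡ φ v → u ≡ v)
    × (∀ u v → InF T r u → InF T r v → Graph._~_ T u v → AdjH (φ u) (φ v))
    × (∀ u → InF T r u → ∃ λ z → InF T r z × SameComp T r u z
         × (∀ w → InF T r w → SameComp T r z w → w ≢ z → Graph._~_ T z w)
         × InY (φ z))

module Submission where

-- A tree of diameter at most four has a vertex of eccentricity at most two, hence so
-- does its centre r. Every vertex v ≠ r then hangs off a unique neighbour of r, its
-- branch vertex, so each component of F_T is a star centred at its branch vertex; its
-- other vertices (the leaves) inject into the edges of F_T via their edge to the centre,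
-- so there are at most e(F_T) of them. Send the branch vertex of the i-th component to
-- y_i and give every leaf its own X-neighbour of the image of its centre, greedily:
-- first the leaves outside component 0, at most e(F_T) − 1 of them because component 0
-- has a leaf, then those of component 0.

open import Defs
open import Data.Nat using (ℕ; zero; suc; _+_; _*_; _∸_; _≤_; _<_; z≤n; s≤s) renaming (_≟_ to _≟ℕ_)
open import Data.Nat.Properties
  using (≤-trans; +-suc; +-comm; m≤m+n; <-≤-trans; <-irrefl; ≮⇒≥; +-monoʳ-≤; m+n≤o⇒m≤o∸n)
open import Data.Fin using (Fin; zero; suc; toℕ) renaming (_<_ to _<ᶠ_)
open import Data.Fin.Properties using (_≟_; any?; ≤∧≢⇒<) renaming (_<?_ to _<ᶠ?_)
open import Data.List using (List; []; _∷_; _++_; [_]; length; head; last; map; filter; allFin; cartesianProduct)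
open import Data.List.Properties using (length-++-sucʳ; length-map; ++-assoc)
open import Data.List.Relation.Unary.All as All using (All; []; _∷_)
open import Data.List.Relation.Unary.All.Properties using (¬Any⇒All¬; All¬⇒¬Any; ++⁻ˡ; map⁺)
open import Data.List.Relation.Unary.AllPairs using ([]; _∷_)
open import Data.List.Relation.Unary.Any as Any using (here; there)
open import Data.List.Relation.Unary.Unique.Propositional using (Unique)
open import Data.List.Relation.Unary.Unique.Propositional.Properties using (filter⁺; allFin⁺)
open import Data.List.Membership.Propositional using (_∈_; _∉_; find)
open import Data.List.Membership.Propositional.Properties
  using ( ∈-∃++; ∈-map⁻; ∈-map⁺; ∈-++⁻; ∈-++⁺ˡ; ∈-++⁺ʳ; ∈-filter⁺; ∈-filter⁻; ∈-allFin
        ; ∈-cartesianProduct⁺; ∈-length)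
open import Data.Maybe using (just)
open import Data.Product using (∃; ∃₂; _×_; _,_; proj₁; proj₂)
open import Data.Sum using (_⊎_; inj₁; inj₂)
open import Data.Sum.Properties using (inj₁-injective; inj₂-injective)
open import Data.Empty using (⊥; ⊥-elim)
open import Data.Unit using (tt)
open import Function using (_∘_)
open import Function.Definitions using (Injective)
open import Relation.Unary using (Decidable)
open import Relation.Nullary using (¬_; Dec; yes; no)
open import Relation.Nullary.Decidable using (_×-dec_; ¬?; decidable-stable)
open import Relation.Binary.Definitions using (DecidableEquality)
open import Relation.Binary.PropositionalEquality
  using (_≡_; _≢_; refl; sym; trans; cong; subst; ≢-sym; module ≡-Reasoning)

module _ {A : Set} where

  last-∷ʳ : ∀ (xs : List A) x → last (xs ++ [ x ]) ≡ just x
  last-∷ʳ []           x = refl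
  last-∷ʳ (_ ∷ [])     x = refl
  last-∷ʳ (_ ∷ y ∷ xs) x = last-∷ʳ (y ∷ xs) x

  last-++-∷ : ∀ (xs : List A) y ys → last (xs ++ y ∷ ys) ≡ last (y ∷ ys)
  last-++-∷ []           y ys = refl
  last-++-∷ (_ ∷ [])     y ys = refl
  last-++-∷ (_ ∷ x ∷ xs) y ys = last-++-∷ (x ∷ xs) y ys

  last-∷ : ∀ (x : A) xs → ∃ λ z → last (x ∷ xs) ≡ just z
  last-∷ x []       = x , refl
  last-∷ x (y ∷ xs) = last-∷ y xs

  last⇒∈ : ∀ (xs : List A) {z} → last xs ≡ just z → z ∈ xs
  last⇒∈ (_ ∷ [])     refl = here refl
  last⇒∈ (_ ∷ y ∷ xs) eq   = there (last⇒∈ (y ∷ xs) eq)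

  Unique-++⁻ˡ : ∀ (xs : List A) {ys} → Unique (xs ++ ys) → Unique xs
  Unique-++⁻ˡ []       _        = []
  Unique-++⁻ˡ (x ∷ xs) (x∉ ∷ u) = ++⁻ˡ xs x∉ ∷ Unique-++⁻ˡ xs u

  Unique-++⁻ʳ : ∀ (xs : List A) {ys} → Unique (xs ++ ys) → Unique ys
  Unique-++⁻ʳ []       u       = u
  Unique-++⁻ʳ (_ ∷ xs) (_ ∷ u) = Unique-++⁻ʳ xs u

  ∈-remove : ∀ {x y} (pre : List A) {suf} → y ∈ pre ++ x ∷ suf → y ≢ x → y ∈ pre ++ suf
  ∈-remove []        (here y≡x) y≢x = ⊥-elim (y≢x y≡x)
  ∈-remove []        (there y∈) _   = y∈
  ∈-remove (_ ∷ _)   (here y≡p) _   = here y≡p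
  ∈-remove (_ ∷ pre) (there y∈) y≢x = there (∈-remove pre y∈ y≢x)

  Unique-⊆⇒length≤ : ∀ {xs ws : List A} → Unique xs → All (_∈ ws) xs → length xs ≤ length ws
  Unique-⊆⇒length≤ {[]}     _         _          = z≤n
  Unique-⊆⇒length≤ {x ∷ xs} (x∉ ∷ u) (x∈ws ∷ xs⊆ws) with ∈-∃++ x∈ws
  ... | pre , suf , refl = subst (suc (length xs) ≤_) (sym (length-++-sucʳ pre x suf))
    (s≤s (Unique-⊆⇒length≤ u (All.zipWith (λ (x≢ , ∈ws) → ∈-remove pre ∈ws (≢-sym x≢)) (x∉ , xs⊆ws))))

module _ {A B : Set} (f : A → B) where

  Unique-map⁺ : ∀ {xs} → Unique xs → (∀ {x y} → x ∈ xs → y ∈ xs → f x ≡ f y → x ≡ y) → Unique (map f xs)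
  Unique-map⁺ {[]}     _        _   = []
  Unique-map⁺ {x ∷ xs} (x∉ ∷ u) inj =
    ¬Any⇒All¬ _ fx∉ ∷ Unique-map⁺ u (λ x∈ y∈ → inj (there x∈) (there y∈))
    where
      fx∉ : f x ∉ map f xs
      fx∉ fx∈ with ∈-map⁻ f fx∈
      ... | y , y∈ , fx≡fy = All¬⇒¬Any x∉ (subst (_∈ xs) (sym (inj (here refl) (there y∈) fx≡fy)) y∈)

module _ {A : Set} {P : A → Set} (P? : Decidable P) where

  length-filter+length-filter-¬ : ∀ xs → length (filter P? xs) + length (filter (λ x → ¬? (P? x)) xs) ≡ length xs
  length-filter+length-filter-¬ []       = refl
  length-filter+length-filter-¬ (x ∷ xs) with P? x
  ... | yes _ = cong suc (length-filter+length-filter-¬ xs)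
  ... | no  _ = trans (+-suc _ _) (cong suc (length-filter+length-filter-¬ xs))

∀⊎∃ : ∀ {n} {A B : Fin n → Set} → (∀ i → A i ⊎ B i) → (∀ i → A i) ⊎ ∃ B
∀⊎∃ {zero}  _ = inj₁ λ ()
∀⊎∃ {suc n} {A} {B} f with f zero | ∀⊎∃ {n} {A ∘ suc} {B ∘ suc} (f ∘ suc)
... | inj₂ b | _            = inj₂ (zero , b)
... | inj₁ _ | inj₂ (i , b) = inj₂ (suc i , b)
... | inj₁ a | inj₁ as      = inj₁ λ { zero → a ; (suc i) → as i }

module Walks {n : ℕ} (G : Graph n) where
  open Graph G
  open import Data.List.Membership.DecPropositional (_≟_ {n}) using (_∈?_)

  IsPath : List (Fin n) → Set
  IsPath P = Unique P × IsWalk G P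

  PathFromTo : Fin n → Fin n → List (Fin n) → Set
  PathFromTo x z P = Unique P × WalkFromTo G x z P

  IsWalk-++⁻ˡ : ∀ xs {ys} → IsWalk G (xs ++ ys) → IsWalk G xs
  IsWalk-++⁻ˡ []           _          = tt
  IsWalk-++⁻ˡ (_ ∷ [])     _          = tt
  IsWalk-++⁻ˡ (_ ∷ y ∷ xs) (x~y , wk) = x~y , IsWalk-++⁻ˡ (y ∷ xs) wk

  IsWalk-++⁻ʳ : ∀ xs {ys} → IsWalk G (xs ++ ys) → IsWalk G ys
  IsWalk-++⁻ʳ []                    wk       = wk
  IsWalk-++⁻ʳ (_ ∷ []) {[]}         _        = tt
  IsWalk-++⁻ʳ (_ ∷ []) {_ ∷ _}      (_ , wk) = wk
  IsWalk-++⁻ʳ (_ ∷ y ∷ xs)          (_ , wk) = IsWalk-++⁻ʳ (y ∷ xs) wk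

  IsPath-++⁻ˡ : ∀ xs {ys} → IsPath (xs ++ ys) → IsPath xs
  IsPath-++⁻ˡ xs (u , wk) = Unique-++⁻ˡ xs u , IsWalk-++⁻ˡ xs wk

  walk⇒path : ∀ {x z} W → WalkFromTo G x z W → ∃ (PathFromTo x z)
  walk⇒path [] (_ , () , _)
  walk⇒path (x ∷ []) (_ , refl , refl) = [ x ] , [] ∷ [] , tt , refl , refl
  walk⇒path (x ∷ w ∷ W) ((x~w , wk) , refl , lW) with walk⇒path (w ∷ W) (wk , refl , lW)
  ... | [] , _ , _ , () , _
  ... | P@(_ ∷ _) , u , wkP , refl , lP with x ∈? P
  ...   | no x∉ = x ∷ P , (¬Any⇒All¬ P x∉ ∷ u) , (x~w , wkP) , refl , lP
  ...   | yes x∈ with ∈-∃++ x∈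
  ...     | pre , suf , P≡ =
            x ∷ suf , Unique-++⁻ʳ pre (subst Unique P≡ u) , IsWalk-++⁻ʳ pre (subst (IsWalk G) P≡ wkP) , refl ,
            trans (sym (last-++-∷ pre x suf)) (trans (cong last (sym P≡)) lP)

  ~⇒≢ : ∀ {u v} → u ~ v → u ≢ v
  ~⇒≢ u~v refl = ~-irr u~v

module Forest {n : ℕ} (G : Graph n) (acyclic : Acyclic G) where
  open Graph G
  open Walks G

  no-closing-edge : ∀ {v p q rest} → IsPath (p ∷ q ∷ rest) → v ∈ rest → ¬ v ~ p
  no-closing-edge {v} {p} {q} {rest} P v∈ v~p with ∈-∃++ v∈
  ... | pre , suf , rest≡ = acyclic cycle
    (s≤s (s≤s (subst (1 ≤_) (sym (length-++-sucʳ pre v [])) (s≤s z≤n))) ,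
     proj₁ cycle-path , proj₂ cycle-path , p , v , refl , last-∷ʳ (p ∷ q ∷ pre) v , v~p)
    where
      cycle = p ∷ q ∷ pre ++ [ v ]
      cycle-path : IsPath cycle
      cycle-path = IsPath-++⁻ˡ cycle
        (subst IsPath (cong (λ l → p ∷ q ∷ l) (trans rest≡ (sym (++-assoc pre [ v ] suf)))) P)

  path-∷ : ∀ {v p q rest} → IsPath (p ∷ q ∷ rest) → v ~ p → v ≢ q → IsPath (v ∷ p ∷ q ∷ rest)
  path-∷ {v} {p} {q} {rest} P@(u , wk) v~p v≢q = (¬Any⇒All¬ _ v∉ ∷ u) , v~p , wk
    where
      v∉ : v ∉ p ∷ q ∷ rest
      v∉ (here v≡p)         = ~⇒≢ v~p v≡p
      v∉ (there (here v≡q)) = v≢q v≡q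
      v∉ (there (there v∈)) = no-closing-edge P v∈ v~p

  pathFromTo-∷ : ∀ {v p q rest z} → PathFromTo p z (p ∷ q ∷ rest) → v ~ p → v ≢ q →
                 PathFromTo v z (v ∷ p ∷ q ∷ rest)
  pathFromTo-∷ (u , wk , _ , l) v~p v≢q with path-∷ (u , wk) v~p v≢q
  ... | u′ , wk′ = u′ , wk′ , refl , l

  no-triangle : ∀ {a b c} → a ~ b → b ~ c → c ~ a → ⊥
  no-triangle a~b b~c c~a =
    no-closing-edge (((~⇒≢ a~b ∷ ≢-sym (~⇒≢ c~a) ∷ []) ∷ (~⇒≢ b~c ∷ []) ∷ [] ∷ []) , a~b , b~c , tt)
                    (here refl) c~a

  no-4-cycle : ∀ {a b c d} → a ~ b → b ~ c → c ~ d → d ~ a → a ≢ c → b ≢ d → ⊥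
  no-4-cycle a~b b~c c~d d~a a≢c b≢d =
    no-closing-edge (((~⇒≢ a~b ∷ a≢c ∷ ≢-sym (~⇒≢ d~a) ∷ []) ∷ (~⇒≢ b~c ∷ b≢d ∷ []) ∷
                      (~⇒≢ c~d ∷ []) ∷ [] ∷ []) ,
                     a~b , b~c , c~d , tt) (there (here refl)) d~a

  no-5-cycle : ∀ {a b c d e} → a ~ b → b ~ c → c ~ d → d ~ e → e ~ a →
               a ≢ c → a ≢ d → b ≢ d → b ≢ e → c ≢ e → ⊥
  no-5-cycle a~b b~c c~d d~e e~a a≢c a≢d b≢d b≢e c≢e =
    no-closing-edge (((~⇒≢ a~b ∷ a≢c ∷ a≢d ∷ ≢-sym (~⇒≢ e~a) ∷ []) ∷ (~⇒≢ b~c ∷ b≢d ∷ b≢e ∷ []) ∷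
                      (~⇒≢ c~d ∷ c≢e ∷ []) ∷ (~⇒≢ d~e ∷ []) ∷ [] ∷ []) ,
                     a~b , b~c , c~d , d~e , tt) (there (there (here refl))) e~a

  -- Paths are unique in a forest: a walk between the ends of a path
  -- that leaves it would close a cycle.
  walk-visits-path : ∀ x W {R z} → PathFromTo x z R → WalkFromTo G x z (x ∷ W) → All (_∈ x ∷ W) R
  walk-visits-path x W       {[]}         (_ , _ , () , _)  _
  walk-visits-path x W       {_ ∷ []}     (_ , _ , refl , _) _ = here refl ∷ []
  walk-visits-path x []      {_ ∷ r ∷ R} ((x∉ ∷ _) , _ , refl , lR) (_ , _ , refl) =
    ⊥-elim (All¬⇒¬Any x∉ (last⇒∈ (r ∷ R) lR))
  walk-visits-path x (w ∷ W) {_ ∷ r ∷ R} P@((_ ∷ u) , (_ , wkR) , refl , lR) ((x~w , wkW) , _ , lW) with w ≟ r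
  ... | yes refl = here refl ∷ All.map there (walk-visits-path w W (u , wkR , refl , lR) (wkW , refl , lW))
  ... | no w≢r   = All.map there (All.tail (walk-visits-path w W (pathFromTo-∷ P (~-sym x~w) w≢r) (wkW , refl , lW)))

  path-length≤walk-length : ∀ {x z R W} → PathFromTo x z R → WalkFromTo G x z W → length R ≤ length W
  path-length≤walk-length {W = []}    _ (_ , () , _)
  path-length≤walk-length {W = _ ∷ W} P walk@(_ , refl , _) = Unique-⊆⇒length≤ (proj₁ P) (walk-visits-path _ W P walk)

  path-length≤ : ∀ {d} → DiamLe G d → ∀ R → IsPath R → length R ≤ suc d
  path-length≤ _    []      _        = z≤n
  path-length≤ diam (x ∷ R) (u , wk) with last-∷ x R
  ... | z , lR with diam x z
  ... | W , walk , len = ≤-trans (path-length≤walk-length (u , wk , refl , lR) walk) len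

module Radius {n : ℕ} (G : Graph n) (acyclic : Acyclic G) (diam : DiamLe G 4) where
  open Graph G
  open Walks G
  open Forest G acyclic

  no-6-path : ∀ {v₁ v₂ v₃ v₄ v₅ v₆} → ¬ IsPath (v₁ ∷ v₂ ∷ v₃ ∷ v₄ ∷ v₅ ∷ v₆ ∷ [])
  no-6-path P with path-length≤ diam _ P
  ... | s≤s (s≤s (s≤s (s≤s (s≤s ()))))

  LongPathFrom : Fin n → Set
  LongPathFrom w = ∃₂ λ t s → ∃ λ q → IsPath (w ∷ t ∷ s ∷ q ∷ [])

  near-or-long : ∀ w z → DistLe G w z 2 ⊎ LongPathFrom w
  near-or-long w z with diam w z
  ... | W , walk , _ with walk⇒path W walk
  ... | []                    , _ , _ , () , _
  ... | P@(_ ∷ [])            , _ , wk , refl , l = inj₁ (P , (wk , refl , l) , s≤s z≤n)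
  ... | P@(_ ∷ _ ∷ [])        , _ , wk , refl , l = inj₁ (P , (wk , refl , l) , s≤s (s≤s z≤n))
  ... | P@(_ ∷ _ ∷ _ ∷ [])    , _ , wk , refl , l = inj₁ (P , (wk , refl , l) , s≤s (s≤s (s≤s z≤n)))
  ... | (_ ∷ t ∷ s ∷ q ∷ _)   , u , wk , refl , _ = inj₂ (t , s , q , IsPath-++⁻ˡ (w ∷ t ∷ s ∷ q ∷ []) (u , wk))

  ecc≤2-or-long : ∀ w → EccLe G w 2 ⊎ LongPathFrom w
  ecc≤2-or-long w with ∀⊎∃ (near-or-long w)
  ... | inj₁ near      = inj₁ near
  ... | inj₂ (_ , long) = inj₂ long

  -- A path of three edges from b would extend the given path, through a or through c,
  -- to one on six vertices.
  middle-ecc≤2 : ∀ {x a b c u} → IsPath (x ∷ a ∷ b ∷ c ∷ u ∷ []) → EccLe G b 2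
  middle-ecc≤2 {a = a} {b} ((((_ ∷ x≢b ∷ _) ∷ (_ ∷ a≢c ∷ _) ∷ (_ ∷ b≢u ∷ _) ∷ _)) , x~a , a~b , b~c , c~u , _) z
    with near-or-long b z
  ... | inj₁ near = near
  ... | inj₂ (t , _ , _ , Q) with t ≟ a
  ...   | no t≢a   = ⊥-elim (no-6-path (path-∷ (path-∷ Q a~b (≢-sym t≢a)) x~a x≢b))
  ...   | yes refl = ⊥-elim (no-6-path (path-∷ (path-∷ Q (~-sym b~c) (≢-sym a≢c)) (~-sym c~u) (≢-sym b≢u)))

  radius≤2 : Fin n → ∃ λ v → EccLe G v 2
  radius≤2 w with ecc≤2-or-long w
  ... | inj₁ ecc = w , ecc
  ... | inj₂ (t , _ , _ , ((_ ∷ w≢s ∷ _) ∷ _) , w~t , t~s , _) with ecc≤2-or-long t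
  ...   | inj₁ ecc = t , ecc
  ...   | inj₂ (t′ , _ , _ , Q) with t′ ≟ w
  ...     | no t′≢w  = _ , middle-ecc≤2 (path-∷ Q w~t (≢-sym t′≢w))
  ...     | yes refl = _ , middle-ecc≤2 (path-∷ Q (~-sym t~s) (≢-sym w≢s))

  center-ecc≤2 : ∀ {r} → IsCenter G r → EccLe G r 2
  center-ecc≤2 {r} center = center _ 2 (proj₂ (radius≤2 r))

module Branches {n : ℕ} (G : Graph n) (acyclic : Acyclic G) (r : Fin n) (ecc≤2 : EccLe G r 2) where
  open Graph G
  open Walks G
  open Forest G acyclic

  within-2 : ∀ v → v ≡ r ⊎ r ~ v ⊎ ∃ λ s → r ~ s × s ~ v
  within-2 v with ecc≤2 v
  ... | _ ∷ []          , (_ , refl , refl) , _ = inj₁ refl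
  ... | _ ∷ _ ∷ []      , ((r~v , _) , refl , refl) , _ = inj₂ (inj₁ r~v)
  ... | _ ∷ s ∷ _ ∷ []  , ((r~s , s~v , _) , refl , refl) , _ = inj₂ (inj₂ (s , r~s , s~v))
  ... | _ ∷ _ ∷ _ ∷ _ ∷ _ , _ , s≤s (s≤s (s≤s ()))

  -- For v ≢ r, the neighbour of r on the path from r to v (junk value v when v ≡ r).
  branch : Fin n → Fin n
  branch v with ~-dec r v
  ... | yes _ = v
  ... | no  _ with any? (λ s → ~-dec r s ×-dec ~-dec s v)
  ...   | yes (s , _) = s
  ...   | no  _       = v

  BranchSpec : Fin n → Set
  BranchSpec v = (r ~ v × branch v ≡ v) ⊎ (¬ r ~ v × r ~ branch v × branch v ~ v)

  branch-spec : ∀ v → v ≢ r → BranchSpec v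
  branch-spec v v≢r with ~-dec r v
  ... | yes r~v = inj₁ (r~v , refl)
  ... | no ¬r~v with any? (λ s → ~-dec r s ×-dec ~-dec s v)
  ...   | yes (_ , r~s , s~v) = inj₂ (¬r~v , r~s , s~v)
  ...   | no  ∄s with within-2 v
  ...     | inj₁ v≡r        = ⊥-elim (v≢r v≡r)
  ...     | inj₂ (inj₁ r~v) = ⊥-elim (¬r~v r~v)
  ...     | inj₂ (inj₂ s)   = ⊥-elim (∄s s)

  r~branch : ∀ {v} → v ≢ r → r ~ branch v
  r~branch {v} v≢r with branch-spec v v≢r
  ... | inj₁ (r~v , eq)   = subst (r ~_) (sym eq) r~v
  ... | inj₂ (_ , r~b , _) = r~b

  branch≢r : ∀ {v} → v ≢ r → branch v ≢ r
  branch≢r v≢r = ≢-sym (~⇒≢ (r~branch v≢r))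

  branch-neighbour : ∀ {c} → r ~ c → branch c ≡ c
  branch-neighbour {c} r~c with ~-dec r c
  ... | yes _    = refl
  ... | no ¬r~c = ⊥-elim (¬r~c r~c)

  common-neighbour-unique : ∀ {v s s′} → v ≢ r → ¬ r ~ v → r ~ s → s ~ v → r ~ s′ → s′ ~ v → s ≡ s′
  common-neighbour-unique {v} {s} {s′} v≢r _ r~s s~v r~s′ s′~v with s ≟ s′
  ... | yes s≡s′ = s≡s′
  ... | no  s≢s′ = ⊥-elim (no-4-cycle r~s s~v (~-sym s′~v) (~-sym r~s′) (≢-sym v≢r) s≢s′)

  branch-edge : ∀ {u w} → u ≢ r → w ≢ r → u ~ w → branch w ≡ branch u
  branch-edge {u} {w} u≢r w≢r u~w with branch-spec u u≢r | branch-spec w w≢r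
  ... | inj₁ (r~u , _) | inj₁ (r~w , _) = ⊥-elim (no-triangle r~u u~w (~-sym r~w))
  ... | inj₁ (r~u , bu≡u) | inj₂ (¬r~w , r~bw , bw~w) =
        trans (common-neighbour-unique w≢r ¬r~w r~bw bw~w r~u u~w) (sym bu≡u)
  ... | inj₂ (¬r~u , r~bu , bu~u) | inj₁ (r~w , bw≡w) =
        trans bw≡w (common-neighbour-unique u≢r ¬r~u r~w (~-sym u~w) r~bu bu~u)
  ... | inj₂ (¬r~u , r~bu , bu~u) | inj₂ (¬r~w , r~bw , bw~w) with branch w ≟ branch u
  ...   | yes bw≡bu = bw≡bu
  ...   | no  bw≢bu = ⊥-elim (no-5-cycle r~bu bu~u u~w (~-sym bw~w) (~-sym r~bw)
                        (≢-sym u≢r) (≢-sym w≢r) (λ bu≡w → ¬r~w (subst (r ~_) bu≡w r~bu)) (≢-sym bw≢bu)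
                        (λ u≡bw → ¬r~u (subst (r ~_) (sym u≡bw) r~bw)))

  branch-walk : ∀ xs {u v} → IsWalk G xs → All (_≢ r) xs → head xs ≡ just u → last xs ≡ just v → branch v ≡ branch u
  branch-walk (_ ∷ [])     _          _                   refl refl = refl
  branch-walk (x ∷ w ∷ xs) (x~w , wk) (x≢r ∷ w≢r ∷ avoid) refl l    =
    trans (branch-walk (w ∷ xs) wk (w≢r ∷ avoid) refl l) (branch-edge x≢r w≢r x~w)

  branch-sameComp : ∀ {u v} → SameComp G r u v → branch v ≡ branch u
  branch-sameComp (xs , (wk , h , l) , avoid) = branch-walk xs wk avoid h l

  sameComp-branch : ∀ {u} → u ≢ r → SameComp G r u (branch u)
  sameComp-branch {u} u≢r with branch-spec u u≢r
  ... | inj₁ (_ , bu≡u)      = u ∷ [] , (tt , refl , cong just (sym bu≡u)) , u≢r ∷ []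
  ... | inj₂ (_ , _ , bu~u) = u ∷ branch u ∷ [] , ((~-sym bu~u , tt) , refl , refl) , u≢r ∷ branch≢r u≢r ∷ []

  branch≡⇒sameComp : ∀ {u v} → u ≢ r → v ≢ r → branch u ≡ branch v → SameComp G r u v
  branch≡⇒sameComp {u} {v} u≢r v≢r bu≡bv with branch-spec u u≢r | branch-spec v v≢r
  ... | inj₁ (_ , bu≡u) | inj₁ (_ , bv≡v) =
        u ∷ [] , (tt , refl , cong just (trans (sym bu≡u) (trans bu≡bv bv≡v))) , u≢r ∷ []
  ... | inj₁ (_ , bu≡u) | inj₂ (_ , _ , bv~v) =
        u ∷ v ∷ [] , ((subst (_~ v) (trans (sym bu≡bv) bu≡u) bv~v , tt) , refl , refl) , u≢r ∷ v≢r ∷ []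
  ... | inj₂ (_ , _ , bu~u) | inj₁ (_ , bv≡v) =
        u ∷ v ∷ [] , ((~-sym (subst (_~ u) (trans bu≡bv bv≡v) bu~u) , tt) , refl , refl) , u≢r ∷ v≢r ∷ []
  ... | inj₂ (_ , _ , bu~u) | inj₂ (_ , _ , bv~v) =
        u ∷ branch u ∷ v ∷ [] , ((~-sym bu~u , subst (_~ v) (sym bu≡bv) bv~v , tt) , refl , refl) ,
        u≢r ∷ branch≢r u≢r ∷ v≢r ∷ []

  InF-branch : ∀ {u} → InF G r u → InF G r (branch u)
  InF-branch {u} (u≢r , w , w≢r , u~w) with branch-spec u u≢r
  ... | inj₁ (_ , bu≡u)      = branch≢r u≢r , w , w≢r , subst (_~ w) (sym bu≡u) u~w
  ... | inj₂ (_ , _ , bu~u) = branch≢r u≢r , u , u≢r , bu~u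

  branch-centres-star : ∀ {c w} → w ≢ r → branch w ≡ c → w ≢ c → c ~ w
  branch-centres-star {c} {w} w≢r bw≡c w≢c with branch-spec w w≢r
  ... | inj₁ (_ , bw≡w)      = ⊥-elim (w≢c (trans (sym bw≡w) bw≡c))
  ... | inj₂ (_ , _ , bw~w) = subst (_~ w) bw≡c bw~w

module Leaves {n : ℕ} (G : Graph n) (acyclic : Acyclic G) (r : Fin n) (ecc≤2 : EccLe G r 2) where
  open Graph G
  open Walks G using (~⇒≢)
  open Forest G acyclic using (no-triangle)
  open Branches G acyclic r ecc≤2

  Leaf : Fin n → Set
  Leaf v = InF G r v × ¬ r ~ v

  leaf? : Decidable Leaf
  leaf? v = (¬? (v ≟ r) ×-dec any? (λ w → ¬? (w ≟ r) ×-dec ~-dec v w)) ×-dec ¬? (~-dec r v)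

  leaves : List (Fin n)
  leaves = filter leaf? (allFin n)

  Unique-leaves : Unique leaves
  Unique-leaves = filter⁺ leaf? (allFin⁺ n)

  ∈-leaves : ∀ {v} → Leaf v → v ∈ leaves
  ∈-leaves = ∈-filter⁺ leaf? (∈-allFin _)

  -- Literally the list counted by eF G r, so that its length is eF G r by definition.
  edges-off-root : List (Fin n × Fin n)
  edges-off-root = filter off-root? (cartesianProduct (allFin n) (allFin n))
    where
      off-root? : (p : Fin n × Fin n) → Dec (((proj₁ p <ᶠ proj₂ p) × (proj₁ p ~ proj₂ p))
                                              × ((¬ proj₁ p ≡ r) × (¬ proj₂ p ≡ r)))
      off-root? (u , v) = ((u <ᶠ? v) ×-dec ~-dec u v) ×-dec (¬? (u ≟ r) ×-dec ¬? (v ≟ r))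

  leaf-edge : Fin n → Fin n × Fin n
  leaf-edge v with v <ᶠ? branch v
  ... | yes _ = v , branch v
  ... | no  _ = branch v , v

  leaf-edge∈ : ∀ {v} → Leaf v → leaf-edge v ∈ edges-off-root
  leaf-edge∈ {v} ((v≢r , _) , ¬r~v) with branch-spec v v≢r
  ... | inj₁ (r~v , _)       = ⊥-elim (¬r~v r~v)
  ... | inj₂ (_ , _ , b~v) with v <ᶠ? branch v
  ...   | yes v<b = ∈-filter⁺ _ (∈-cartesianProduct⁺ (∈-allFin v) (∈-allFin (branch v)))
                      ((v<b , ~-sym b~v) , v≢r , branch≢r v≢r)
  ...   | no  v≮b = ∈-filter⁺ _ (∈-cartesianProduct⁺ (∈-allFin (branch v)) (∈-allFin v))
                      ((≤∧≢⇒< (≮⇒≥ v≮b) (~⇒≢ b~v) , b~v) , branch≢r v≢r , v≢r)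

  leaf-edge-injective : ∀ {u v} → Leaf u → Leaf v → leaf-edge u ≡ leaf-edge v → u ≡ v
  leaf-edge-injective {u} {v} (_ , ¬r~u) ((v≢r , _) , _) eq with u <ᶠ? branch u | v <ᶠ? branch v
  ... | yes _ | yes _ = cong proj₁ eq
  ... | no  _ | no  _ = cong proj₂ eq
  ... | yes _ | no  _ = ⊥-elim (¬r~u (subst (r ~_) (sym (cong proj₁ eq)) (r~branch v≢r)))
  ... | no  _ | yes _ = ⊥-elim (¬r~u (subst (r ~_) (sym (cong proj₂ eq)) (r~branch v≢r)))

  #leaves≤eF : length leaves ≤ eF G r
  #leaves≤eF = subst (_≤ eF G r) (length-map leaf-edge leaves)
    (Unique-⊆⇒length≤ (Unique-map⁺ leaf-edge Unique-leaves (λ u∈ v∈ → leaf-edge-injective (leaf u∈) (leaf v∈)))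
                       (map⁺ (All.tabulate λ v∈ → leaf-edge∈ (leaf v∈))))
    where
      leaf : ∀ {v} → v ∈ leaves → Leaf v
      leaf v∈ = proj₂ (∈-filter⁻ leaf? {xs = allFin n} v∈)

  leaves-nonadjacent : ∀ {u v} → Leaf u → Leaf v → ¬ u ~ v
  leaves-nonadjacent {u} {v} ((u≢r , _) , ¬r~u) ((v≢r , _) , ¬r~v) u~v with branch-spec u u≢r | branch-spec v v≢r
  ... | inj₁ (r~u , _) | _ = ¬r~u r~u
  ... | _ | inj₁ (r~v , _) = ¬r~v r~v
  ... | inj₂ (_ , _ , bu~u) | inj₂ (_ , _ , bv~v) =
        no-triangle bu~u u~v (~-sym (subst (_~ v) (branch-edge u≢r v≢r u~v) bv~v))

module Greedy {a b : ℕ} (H : BipGraph a b) where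
  open BipGraph H
  open import Data.List.Membership.DecPropositional (_≟_ {a}) using (_∈?_)

  fresh-neighbour : ∀ y (used : List (Fin a)) → length used < degY H y → ∃ λ x → E x y × x ∉ used
  fresh-neighbour y used lt with Any.any? (λ x → ¬? (x ∈? used)) (filter (λ x → E-dec x y) (allFin a))
  ... | yes some with find some
  ...   | x , x∈N , x∉ = x , proj₂ (∈-filter⁻ (λ x → E-dec x y) {xs = allFin a} x∈N) , x∉
  fresh-neighbour y used lt | no none =
    ⊥-elim (<-irrefl refl (<-≤-trans lt (Unique-⊆⇒length≤ (filter⁺ (λ x → E-dec x y) (allFin⁺ a))
      (All.map (λ {x} → decidable-stable (x ∈? used)) (¬Any⇒All¬ _ none)))))

  module _ {V : Set} (_≟ᵥ_ : DecidableEquality V) (nb : V → Fin b) where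

    record Assignment (vs : List V) (used : List (Fin a)) : Set where
      field
        pick      : V → Fin a
        adjacent  : ∀ {v} → v ∈ vs → E (pick v) (nb v)
        fresh     : ∀ {v} → v ∈ vs → pick v ∉ used
        injective : ∀ {u v} → u ∈ vs → v ∈ vs → pick u ≡ pick v → u ≡ v

    private
      +-suc-≤ : ∀ {m k d} → m + suc k ≤ d → suc (m + k) ≤ d
      +-suc-≤ {m} {k} {d} = subst (_≤ d) (+-suc m k)

    greedy : Fin a → ∀ vs → Unique vs → ∀ used →
             (∀ {v} → v ∈ vs → length used + length vs ≤ degY H (nb v)) → Assignment vs used
    greedy x₀ []       _        _    _    = record { pick = λ _ → x₀ ; adjacent = λ () ; fresh = λ () ; injective = λ () }
    greedy x₀ (v ∷ vs) (v∉ ∷ u) used room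
      with fresh-neighbour (nb v) used (≤-trans (s≤s (m≤m+n (length used) (length vs))) (+-suc-≤ (room (here refl))))
    ... | x , x~v , x∉ = record { pick = pick′ ; adjacent = adjacent′ ; fresh = fresh′ ; injective = injective′ }
      where
        open Assignment (greedy x₀ vs u (x ∷ used) (λ w∈ → +-suc-≤ (room (there w∈))))

        pick′ : V → Fin a
        pick′ w with w ≟ᵥ v
        ... | yes _ = x
        ... | no  _ = pick w

        ∈-tail : ∀ {w} → w ∈ v ∷ vs → w ≢ v → w ∈ vs
        ∈-tail (here w≡v) w≢v = ⊥-elim (w≢v w≡v)
        ∈-tail (there w∈) _   = w∈

        adjacent′ : ∀ {w} → w ∈ v ∷ vs → E (pick′ w) (nb w)
        adjacent′ {w} w∈ with w ≟ᵥ v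
        ... | yes refl = x~v
        ... | no  w≢v  = adjacent (∈-tail w∈ w≢v)

        fresh′ : ∀ {w} → w ∈ v ∷ vs → pick′ w ∉ used
        fresh′ {w} w∈ with w ≟ᵥ v
        ... | yes _   = x∉
        ... | no  w≢v = λ pw∈ → fresh (∈-tail w∈ w≢v) (there pw∈)

        injective′ : ∀ {w w′} → w ∈ v ∷ vs → w′ ∈ v ∷ vs → pick′ w ≡ pick′ w′ → w ≡ w′
        injective′ {w} {w′} w∈ w′∈ eq with w ≟ᵥ v | w′ ≟ᵥ v
        ... | yes refl | yes refl = refl
        ... | yes _    | no  w′≢v = ⊥-elim (fresh (∈-tail w′∈ w′≢v) (here (sym eq)))
        ... | no  w≢v  | yes _    = ⊥-elim (fresh (∈-tail w∈ w≢v) (here eq))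
        ... | no  w≢v  | no  w′≢v = injective (∈-tail w∈ w≢v) (∈-tail w′∈ w′≢v) eq

    greedy-++ : Fin a → ∀ vs₁ vs₀ → Unique vs₁ → Unique vs₀ →
                (∀ {v} → v ∈ vs₁ → length vs₁ ≤ degY H (nb v)) →
                (∀ {v} → v ∈ vs₀ → length vs₁ + length vs₀ ≤ degY H (nb v)) → Assignment (vs₁ ++ vs₀) []
    greedy-++ x₀ vs₁ vs₀ u₁ u₀ room₁ room₀ =
      record { pick = pick′ ; adjacent = adjacent′ ; fresh = λ _ () ; injective = injective′ }
      where
        open import Data.List.Membership.DecPropositional _≟ᵥ_ using () renaming (_∈?_ to _∈ᵥ?_)
        module A₁ = Assignment (greedy x₀ vs₁ u₁ [] room₁)
        module A₀ = Assignment (greedy x₀ vs₀ u₀ (map A₁.pick vs₁)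
                      (λ v∈ → subst (λ m → m + length vs₀ ≤ _) (sym (length-map A₁.pick vs₁)) (room₀ v∈)))

        pick′ : V → Fin a
        pick′ w with w ∈ᵥ? vs₁
        ... | yes _ = A₁.pick w
        ... | no  _ = A₀.pick w

        ∈vs₀ : ∀ {w} → w ∈ vs₁ ++ vs₀ → w ∉ vs₁ → w ∈ vs₀
        ∈vs₀ w∈ w∉ with ∈-++⁻ vs₁ w∈
        ... | inj₁ w∈₁ = ⊥-elim (w∉ w∈₁)
        ... | inj₂ w∈₀ = w∈₀

        adjacent′ : ∀ {w} → w ∈ vs₁ ++ vs₀ → E (pick′ w) (nb w)
        adjacent′ {w} w∈ with w ∈ᵥ? vs₁
        ... | yes w∈₁ = A₁.adjacent w∈₁
        ... | no  w∉₁ = A₀.adjacent (∈vs₀ w∈ w∉₁)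

        injective′ : ∀ {w w′} → w ∈ vs₁ ++ vs₀ → w′ ∈ vs₁ ++ vs₀ → pick′ w ≡ pick′ w′ → w ≡ w′
        injective′ {w} {w′} w∈ w′∈ eq with w ∈ᵥ? vs₁ | w′ ∈ᵥ? vs₁
        ... | yes w∈₁ | yes w′∈₁ = A₁.injective w∈₁ w′∈₁ eq
        ... | yes w∈₁ | no  w′∉₁ =
              ⊥-elim (A₀.fresh (∈vs₀ w′∈ w′∉₁) (subst (_∈ _) eq (∈-map⁺ A₁.pick w∈₁)))
        ... | no  w∉₁ | yes w′∈₁ =
              ⊥-elim (A₀.fresh (∈vs₀ w∈ w∉₁) (subst (_∈ _) (sym eq) (∈-map⁺ A₁.pick w′∈₁)))
        ... | no  w∉₁ | no  w′∉₁ = A₀.injective (∈vs₀ w∈ w∉₁) (∈vs₀ w′∈ w′∉₁) eq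

module Embedding {n : ℕ} (T : Graph n) (acyclic : Acyclic T) (r : Fin n) (ecc≤2 : EccLe T r 2)
                 {m : ℕ} (NC : NumComps T r (suc m)) where
  open Graph T
  open Forest T acyclic using (no-triangle)
  open Branches T acyclic r ecc≤2
  open Leaves T acyclic r ecc≤2

  rep : Fin (suc m) → Fin n
  rep = proj₁ NC

  rep-InF : ∀ i → InF T r (rep i)
  rep-InF = proj₁ (proj₂ NC)

  rep-distinct : ∀ i j → SameComp T r (rep i) (rep j) → i ≡ j
  rep-distinct = proj₁ (proj₂ (proj₂ NC))

  rep-covers : ∀ v → InF T r v → ∃ λ i → SameComp T r v (rep i)
  rep-covers = proj₂ (proj₂ (proj₂ NC))

  -- The index of the component of F_T whose branch vertex is c (junk value zero if there is none).
  componentAt : Fin n → Fin (suc m)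
  componentAt c with any? (λ i → branch (rep i) ≟ c)
  ... | yes (i , _) = i
  ... | no  _       = zero

  component : Fin n → Fin (suc m)
  component v = componentAt (branch v)

  component-spec : ∀ {v} → InF T r v → branch (rep (component v)) ≡ branch v
  component-spec {v} v∈F with any? (λ i → branch (rep i) ≟ branch v)
  ... | yes (_ , eq) = eq
  ... | no  ∄i       = ⊥-elim (∄i (proj₁ (rep-covers v v∈F) , branch-sameComp (proj₂ (rep-covers v v∈F))))

  component-rep : ∀ {v} i → InF T r v → branch v ≡ branch (rep i) → component v ≡ i
  component-rep {v} i v∈F bv≡bi =
    rep-distinct _ i (branch≡⇒sameComp (proj₁ (rep-InF _)) (proj₁ (rep-InF i)) (trans (component-spec v∈F) bv≡bi))

  component-edge : ∀ {u v} → u ≢ r → v ≢ r → u ~ v → component v ≡ component u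
  component-edge u≢r v≢r u~v = cong componentAt (branch-edge u≢r v≢r u~v)

  leaf-with-branch : ∀ {c} → InF T r c → ∃ λ ℓ → Leaf ℓ × branch ℓ ≡ branch c
  leaf-with-branch {c} c∈F@(c≢r , w , w≢r , c~w) = by-cases (~-dec r c)
    where
      by-cases : Dec (r ~ c) → ∃ λ ℓ → Leaf ℓ × branch ℓ ≡ branch c
      by-cases (no  ¬r~c) = c , (c∈F , ¬r~c) , refl
      by-cases (yes r~c)  = w , ((w≢r , c , c≢r , ~-sym c~w) , λ r~w → no-triangle r~c c~w (~-sym r~w)) ,
                            branch-edge c≢r w≢r c~w

  InFirst? : ∀ v → Dec (toℕ (component v) ≡ 0)
  InFirst? v = toℕ (component v) ≟ℕ 0

  leaves₀ leaves₁ : List (Fin n)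
  leaves₀ = filter InFirst? leaves
  leaves₁ = filter (¬? ∘ InFirst?) leaves

  first-component-has-leaf : ∃ λ ℓ → ℓ ∈ leaves₀
  first-component-has-leaf with leaf-with-branch (rep-InF zero)
  ... | ℓ , ℓ-leaf , bℓ≡b0 =
        ℓ , ∈-filter⁺ InFirst? (∈-leaves ℓ-leaf) (cong toℕ (component-rep zero (proj₁ ℓ-leaf) bℓ≡b0))

  0<eF : 0 < eF T r
  0<eF = ≤-trans (∈-length (∈-leaves (proj₁ (proj₂ (leaf-with-branch (rep-InF zero)))))) #leaves≤eF

  #leaves₁+#leaves₀≤eF : length leaves₁ + length leaves₀ ≤ eF T r
  #leaves₁+#leaves₀≤eF = subst (_≤ eF T r) length-leaves #leaves≤eF
    where
      length-leaves : length leaves ≡ length leaves₁ + length leaves₀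
      length-leaves = sym (trans (+-comm (length leaves₁) (length leaves₀))
                                 (length-filter+length-filter-¬ InFirst? leaves))

  #leaves₁≤eF∸1 : length leaves₁ ≤ eF T r ∸ 1
  #leaves₁≤eF∸1 = m+n≤o⇒m≤o∸n (length leaves₁)
    (≤-trans (+-monoʳ-≤ (length leaves₁) (∈-length (proj₂ first-component-has-leaf))) #leaves₁+#leaves₀≤eF)

  ∈-leaves₁++leaves₀ : ∀ {v} → Leaf v → v ∈ leaves₁ ++ leaves₀
  ∈-leaves₁++leaves₀ {v} v-leaf with InFirst? v
  ... | yes first = ∈-++⁺ʳ leaves₁ (∈-filter⁺ InFirst? (∈-leaves v-leaf) first)
  ... | no  other = ∈-++⁺ˡ (∈-filter⁺ (¬? ∘ InFirst?) (∈-leaves v-leaf) other)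

  module _ {a b : ℕ} (H : BipGraph a b) (eF≤a : eF T r ≤ a)
           (y : Fin (suc m) → Fin b) (y-injective : Injective _≡_ _≡_ y)
           (deg₀ : ∀ i → toℕ i ≡ 0 → eF T r ≤ degY H (y i))
           (deg₁ : ∀ i → toℕ i ≢ 0 → eF T r ∸ 1 ≤ degY H (y i)) where
    open BipGraph H
    open Greedy H

    x₀ : Fin a
    x₀ with ≤-trans 0<eF eF≤a
    ... | s≤s _ = zero

    open Assignment (greedy-++ _≟_ (y ∘ component) x₀ leaves₁ leaves₀
           (filter⁺ (¬? ∘ InFirst?) Unique-leaves) (filter⁺ InFirst? Unique-leaves)
           (λ v∈ → ≤-trans #leaves₁≤eF∸1 (deg₁ _ (proj₂ (∈-filter⁻ (¬? ∘ InFirst?) {xs = leaves} v∈))))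
           (λ v∈ → ≤-trans #leaves₁+#leaves₀≤eF (deg₀ _ (proj₂ (∈-filter⁻ InFirst? {xs = leaves} v∈)))))

    φ : Fin n → VH H
    φ v with ~-dec r v
    ... | yes _ = inj₂ (y (component v))
    ... | no  _ = inj₁ (pick v)

    φ-injective : ∀ u v → InF T r u → InF T r v → φ u ≡ φ v → u ≡ v
    φ-injective u v u∈F v∈F with ~-dec r u | ~-dec r v
    ... | yes r~u  | yes r~v  = λ eq → begin
      u                         ≡⟨ sym (branch-neighbour r~u) ⟩
      branch u                  ≡⟨ sym (component-spec u∈F) ⟩
      branch (rep (component u)) ≡⟨ cong (branch ∘ rep) (y-injective (inj₂-injective eq)) ⟩
      branch (rep (component v)) ≡⟨ component-spec v∈F ⟩
      branch v                  ≡⟨ branch-neighbour r~v ⟩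
      v                         ∎
      where open ≡-Reasoning
    ... | no  ¬r~u | no  ¬r~v =
          injective (∈-leaves₁++leaves₀ (u∈F , ¬r~u)) (∈-leaves₁++leaves₀ (v∈F , ¬r~v)) ∘ inj₁-injective
    ... | yes _    | no  _    = λ ()
    ... | no  _    | yes _    = λ ()

    φ-adjacent : ∀ u v → InF T r u → InF T r v → u ~ v → AdjH H (φ u) (φ v)
    φ-adjacent u v u∈F@(u≢r , _) v∈F@(v≢r , _) u~v with ~-dec r u | ~-dec r v
    ... | yes r~u  | yes r~v  = ⊥-elim (no-triangle r~u u~v (~-sym r~v))
    ... | yes _    | no  ¬r~v =
          subst (λ i → E (pick v) (y i)) (component-edge u≢r v≢r u~v)
            (adjacent (∈-leaves₁++leaves₀ (v∈F , ¬r~v)))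
    ... | no  ¬r~u | yes _    =
          subst (λ i → E (pick u) (y i)) (component-edge v≢r u≢r (~-sym u~v))
            (adjacent (∈-leaves₁++leaves₀ (u∈F , ¬r~u)))
    ... | no  ¬r~u | no  ¬r~v = ⊥-elim (leaves-nonadjacent (u∈F , ¬r~u) (v∈F , ¬r~v) u~v)

    φ-neighbour∈Y : ∀ {z} → r ~ z → InY H (φ z)
    φ-neighbour∈Y {z} r~z with ~-dec r z
    ... | yes _    = tt
    ... | no  ¬r~z = ⊥-elim (¬r~z r~z)

    φ-centres : ∀ u → InF T r u → ∃ λ z → InF T r z × SameComp T r u z
                  × (∀ w → InF T r w → SameComp T r z w → w ≢ z → z ~ w) × InY H (φ z)
    φ-centres u u∈F@(u≢r , _) = branch u , InF-branch u∈F , sameComp-branch u≢r , star , φ-neighbour∈Y r~bu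
      where
        r~bu = r~branch u≢r
        star : ∀ w → InF T r w → SameComp T r (branch u) w → w ≢ branch u → branch u ~ w
        star w (w≢r , _) bu≈w w≢bu =
          branch-centres-star w≢r (trans (branch-sameComp bu≈w) (branch-neighbour r~bu)) w≢bu

    copy : CopyWithCentersInY H T r
    copy = φ , φ-injective , φ-adjacent , φ-centres

lemma2p4 : (k : ℕ) → 1 ≤ k →
    (T : Graph (2 * k + 3)) → IsTree T → DiamLe T 4 →
    (r : Fin (2 * k + 3)) → IsRoot T r →
    (p' : ℕ) → NumComps T r p' → 2 ≤ p' →
    (a b : ℕ) → (H : BipGraph a b) →
    eF T r ≤ a → p' ≤ b →
    (y : Fin p' → Fin b) → Injective _≡_ _≡_ y →
    (∀ i → toℕ i ≡ 0 → eF T r ≤ degY H (y i)) →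
    (∀ i → toℕ i ≢ 0 → eF T r ∸ 1 ≤ degY H (y i)) →
    CopyWithCentersInY H T r
lemma2p4 _ _ T (_ , acyclic) diam r (center , _) _ NC (s≤s _) _ _ H eF≤a _ y y-injective deg₀ deg₁ =
  Embedding.copy T acyclic r (Radius.center-ecc≤2 T acyclic diam center) NC H eF≤a y y-injective deg₀ deg₁
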